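{- For each pair $\{\sigma_1,\sigma_2\}\in\{\{1423,1432\},\{3241,2341\},\{4132,4123\},\{2314,3214\}\}$, the set $S_n(\sigma_1,\sigma_2)$ is sign-balanced for every integer $n>1$.
   Context: For $\sigma\in S_k$, $\pi\in S_n$ (one-line notation), $k\le n$, $\pi$ contains $\sigma$ if there are indices $i_1<\cdots<i_k$ with $\pi_{i_s}>\pi_{i_t}$ iff $\sigma_s>\sigma_t$ for all $s<t$; otherwise $\pi$ avoids $\sigma$. $S_n(\sigma_1,\ldots,\sigma_r)$ is the set of permutations in $S_n$ avoiding every $\sigma_j$. A permutation is even (odd) if its number of inversions (pairs $i<j$ with $\pi_i>\pi_j$) is even (odd). A set of permutations is sign-balanced if it contains equally many even and odd permutations. -}

module Defs where

open import Data.Nat using (ℕ; zero; suc; _<ᵇ_; _≡ᵇ_; _%_)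
open import Data.Bool using (Bool; true; false; _∧_; _∨_; not; if_then_else_; T)
open import Data.List using (List; []; _∷_; length; map; _++_)
open import Data.Bool.ListAction using (any; all)
open import Data.Fin using (Fin; toℕ)
open import Data.Vec using (Vec; toList)
open import Data.Product using (Σ; _×_)
open import Function.Bundles using (_↔_)

-- Permutations in one-line notation are lists of natural numbers
-- (values 1..n, or 0..n-1; only relative order matters below).

subseqs : List ℕ → List (List ℕ)
subseqs [] = [] ∷ []
subseqs (x ∷ xs) = map (x ∷_) (subseqs xs) ++ subseqs xs

sameHead : ℕ → ℕ → List ℕ → List ℕ → Bool
sameHead a b [] [] = true
sameHead a b (x ∷ xs) (y ∷ ys) = ((x <ᵇ a) ≡ᵇB (y <ᵇ b)) ∧ sameHead a b xs ys
  where
  _≡ᵇB_ : Bool → Bool → Bool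
  true ≡ᵇB true = true
  false ≡ᵇB false = true
  _ ≡ᵇB _ = false
sameHead a b _ _ = false

orderIso : List ℕ → List ℕ → Bool
orderIso [] [] = true
orderIso (a ∷ as) (b ∷ bs) = sameHead a b as bs ∧ orderIso as bs
orderIso _ _ = false

contains : List ℕ → List ℕ → Bool
contains π σ = any (λ w → orderIso w σ) (subseqs π)

avoids : List ℕ → List ℕ → Bool
avoids π σ = not (contains π σ)

inversions : List ℕ → ℕ
inversions [] = 0
inversions (x ∷ xs) = countLess xs Data.Nat.+ inversions xs
  where
  countLess : List ℕ → ℕ
  countLess [] = 0
  countLess (y ∷ ys) = (if y <ᵇ x then 1 else 0) Data.Nat.+ countLess ys

isEven : List ℕ → Bool
isEven π = (inversions π % 2) ≡ᵇ 0

oneLine : {n : ℕ} → Vec (Fin n) n → List ℕ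
oneLine v = map toℕ (toList v)

-- a vector of length n with entries in Fin n is a permutation iff
-- its entries are pairwise distinct
distinct : List ℕ → Bool
distinct [] = true
distinct (x ∷ xs) = all (λ y → not (x ≡ᵇ y)) xs ∧ distinct xs

inS : (n : ℕ) → List ℕ → List ℕ → Bool → Vec (Fin n) n → Bool
inS n σ₁ σ₂ b v =
  distinct (oneLine v) ∧ avoids (oneLine v) σ₁ ∧ avoids (oneLine v) σ₂
  ∧ (if b then isEven (oneLine v) else not (isEven (oneLine v)))

AvoidersOfParity : (n : ℕ) → List ℕ → List ℕ → Bool → Set
AvoidersOfParity n σ₁ σ₂ b = Σ (Vec (Fin n) n) (λ v → T (inS n σ₁ σ₂ b v))

SignBalanced : (n : ℕ) → List ℕ → List ℕ → Set
SignBalanced n σ₁ σ₂ = AvoidersOfParity n σ₁ σ₂ true ↔ AvoidersOfParity n σ₁ σ₂ false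

pairs : List (List ℕ × List ℕ)
pairs = (1 ∷ 4 ∷ 2 ∷ 3 ∷ [] , 1 ∷ 4 ∷ 3 ∷ 2 ∷ [])
      ∷ (3 ∷ 2 ∷ 4 ∷ 1 ∷ [] , 2 ∷ 3 ∷ 4 ∷ 1 ∷ [])
      ∷ (4 ∷ 1 ∷ 3 ∷ 2 ∷ [] , 4 ∷ 1 ∷ 2 ∷ 3 ∷ [])
      ∷ (2 ∷ 3 ∷ 1 ∷ 4 ∷ [] , 3 ∷ 2 ∷ 1 ∷ 4 ∷ [])
      ∷ []
  where open Data.Product using (_,_)

{-# OPTIONS --safe #-}
module Submission where

-- Each pair has the form {σ, σ∘τ} for τ the transposition of the first two or of
-- the last two positions.  Composing with that τ on the right swaps two adjacent
-- entries of π, so it changes the number of inversions by exactly one; and an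
-- occurrence of σ in π∘τ either avoids one of the two swapped positions, and is
-- then an occurrence of σ in π, or uses both, and then swapping it back gives an
-- occurrence of σ∘τ in π.  Hence π ↦ π∘τ is an involution of S_n(σ, σ∘τ) that
-- reverses the sign for n ≥ 2.

open import Defs
open import Algebra.Bundles using (CommutativeMonoid)
open import Data.Bool using (Bool; true; false; _∧_; not; if_then_else_; T)
open import Data.Bool.ListAction using (all)
open import Data.Bool.Properties using (T-∧; T-irrelevant; not-involutive; ∧-comm; ∧-commutativeMonoid)
open import Data.Empty using (⊥)
open import Data.Unit using (tt)
open import Data.Fin using (Fin; toℕ)
open import Data.List using (List; []; _∷_; [_]; map; length)
open import Data.List.Membership.Propositional using (_∈_)
open import Data.List.Relation.Binary.Sublist.Propositional using (_⊆_; []; _∷_; _∷ʳ_)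
open import Data.List.Relation.Binary.Sublist.Propositional.Properties using (All-resp-⊆)
open import Data.List.Relation.Unary.All.Properties using (all⁺; all⁻)
open import Data.List.Relation.Unary.Any using (Any; here; there)
open import Data.List.Relation.Unary.Any.Properties using (any⁺; any⁻; ++⁺ˡ; ++⁺ʳ; ++⁻; map⁺; map⁻)
open import Data.Nat using (ℕ; zero; suc; pred; _+_; _<_; _<ᵇ_; _≡ᵇ_; _%_; s≤s; z≤n)
open import Data.Nat.Properties using (+-commutativeSemigroup)
open import Data.Product using (_×_; _,_; proj₁; proj₂; ∃-syntax)
open import Data.Sum using (_⊎_; inj₁; inj₂; [_,_]′)
open import Data.Vec using (Vec; toList) renaming ([] to []ᵛ; _∷_ to _∷ᵛ_)
open import Data.Vec.Properties using (toList-injective)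
open import Data.Vec.Relation.Binary.Equality.Cast using (cast-is-id)
open import Function using (_∘_)
open import Function.Bundles using (mk↔ₛ′; Equivalence)
open import Relation.Binary.PropositionalEquality
  using (_≡_; refl; sym; trans; cong; cong₂; subst; module ≡-Reasoning)
open ≡-Reasoning

open import Algebra.Properties.CommutativeSemigroup
  (CommutativeMonoid.commutativeSemigroup ∧-commutativeMonoid)
  using () renaming (interchange to ∧-interchange; x∙yz≈y∙xz to ∧-leftComm)
open import Algebra.Properties.CommutativeSemigroup +-commutativeSemigroup
  using () renaming (x∙yz≈y∙xz to +-leftComm)

private
  variable
    A B : Set
    n : ℕ

T-∧⁻ : ∀ {a b} → T (a ∧ b) → T a × T b
T-∧⁻ = Equivalence.to T-∧

T-∧⁺ : ∀ {a b} → T a → T b → T (a ∧ b)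
T-∧⁺ ta tb = Equivalence.from T-∧ (ta , tb)

T-not⁺ : ∀ {b} → (T b → ⊥) → T (not b)
T-not⁺ {true}  ¬b = ¬b tt
T-not⁺ {false} _  = tt

T-not⁻ : ∀ {b} → T (not b) → T b → ⊥
T-not⁻ {false} _ ()

Σ-T-≡ : ∀ {P : A → Bool} {v w} {p : T (P v)} {q : T (P w)} → v ≡ w → (v , p) ≡ (w , q)
Σ-T-≡ {v = v} refl = cong (v ,_) (T-irrelevant _ _)

≡ᵇ-sym : ∀ m n → (m ≡ᵇ n) ≡ (n ≡ᵇ m)
≡ᵇ-sym zero    zero    = refl
≡ᵇ-sym zero    (suc n) = refl
≡ᵇ-sym (suc m) zero    = refl
≡ᵇ-sym (suc m) (suc n) = ≡ᵇ-sym m n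

<ᵇ-flip : ∀ m n → T (not (m ≡ᵇ n)) → (m <ᵇ n) ≡ not (n <ᵇ m)
<ᵇ-flip zero    (suc n) _   = refl
<ᵇ-flip (suc m) zero    _   = refl
<ᵇ-flip (suc m) (suc n) m≢n = <ᵇ-flip m n m≢n

toList-injective-≡ : (u v : Vec A n) → toList u ≡ toList v → u ≡ v
toList-injective-≡ u v eq = trans (sym (cast-is-id refl u)) (toList-injective refl u v eq)

distinct-tail : ∀ x xs → T (distinct (x ∷ xs)) → T (distinct xs)
distinct-tail x xs = proj₂ ∘ T-∧⁻

distinct-head : ∀ x y xs → T (distinct (x ∷ y ∷ xs)) → T (not (x ≡ᵇ y))
distinct-head x y xs = proj₁ ∘ T-∧⁻ ∘ proj₁ ∘ T-∧⁻

all-⊆ : ∀ (p : ℕ → Bool) {w π} → w ⊆ π → T (all p π) → T (all p w)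
all-⊆ p w⊆π = all⁻ p ∘ All-resp-⊆ w⊆π ∘ all⁺ p _

distinct-⊆ : ∀ {w π} → w ⊆ π → T (distinct π) → T (distinct w)
distinct-⊆ []           d = d
distinct-⊆ {π = x ∷ π} (x ∷ʳ w⊆π) d = distinct-⊆ w⊆π (distinct-tail x π d)
distinct-⊆ (refl ∷ w⊆π) d =
  let (x∉π , dπ) = T-∧⁻ d in T-∧⁺ (all-⊆ _ w⊆π x∉π) (distinct-⊆ w⊆π dπ)

Any-subseqs⁻ : ∀ {P : List ℕ → Set} π → Any P (subseqs π) → ∃[ w ] (w ⊆ π × P w)
Any-subseqs⁻ []       (here p) = [] , [] , p
Any-subseqs⁻ (x ∷ xs) h with ++⁻ (map (x ∷_) (subseqs xs)) h
... | inj₁ h₁ = let (w , w⊆xs , p) = Any-subseqs⁻ xs (map⁻ h₁) in x ∷ w , refl ∷ w⊆xs , p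
... | inj₂ h₂ = let (w , w⊆xs , p) = Any-subseqs⁻ xs h₂ in w , x ∷ʳ w⊆xs , p

Any-subseqs⁺ : ∀ {P : List ℕ → Set} {w π} → w ⊆ π → P w → Any P (subseqs π)
Any-subseqs⁺ []                  p = here p
Any-subseqs⁺ (refl ∷ w⊆π)        p = ++⁺ˡ (map⁺ (Any-subseqs⁺ w⊆π p))
Any-subseqs⁺ {π = x ∷ π} (x ∷ʳ w⊆π) p = ++⁺ʳ (map (x ∷_) (subseqs π)) (Any-subseqs⁺ w⊆π p)

contains⁻ : ∀ π σ → T (contains π σ) → ∃[ w ] (w ⊆ π × T (orderIso w σ))
contains⁻ π σ = Any-subseqs⁻ π ∘ any⁻ _ (subseqs π)

contains⁺ : ∀ {w π} σ → w ⊆ π → T (orderIso w σ) → T (contains π σ)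
contains⁺ σ w⊆π = any⁺ _ ∘ Any-subseqs⁺ w⊆π

orderIso-length : ∀ w s → T (orderIso w s) → length w ≡ length s
orderIso-length []      []      _ = refl
orderIso-length (_ ∷ w) (_ ∷ s) o = cong suc (orderIso-length w s (proj₂ (T-∧⁻ o)))

countLess : ℕ → List ℕ → ℕ
countLess x []       = 0
countLess x (y ∷ ys) = (if y <ᵇ x then 1 else 0) + countLess x ys

-- `inversions` counts with a helper local to its `where` block, which cannot be
-- named.  The meta below is solved to that helper (with the clause variable xs
-- as an extra argument) by unification against `refl`; the `with` turns y ∷ ys
-- into a variable so that the problem is in the pattern fragment.
mutual
  countLessIn : ℕ → List ℕ → List ℕ → ℕ
  countLessIn = _

  inversions-∷∷ : ∀ x y ys →
    inversions (x ∷ y ∷ ys) ≡ ((if y <ᵇ x then 1 else 0) + countLessIn x (y ∷ ys) ys) + inversions (y ∷ ys)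
  inversions-∷∷ x y ys with y ∷ ys
  ... | _ = refl

countLessIn≡countLess : ∀ x zs ys → countLessIn x zs ys ≡ countLess x ys
countLessIn≡countLess x zs []       = refl
countLessIn≡countLess x zs (y ∷ ys) = cong ((if y <ᵇ x then 1 else 0) +_) (countLessIn≡countLess x zs ys)

inversions-∷ : ∀ x xs → inversions (x ∷ xs) ≡ countLess x xs + inversions xs
inversions-∷ x []       = refl
inversions-∷ x (y ∷ ys) =
  trans (inversions-∷∷ x y ys)
        (cong (λ c → ((if y <ᵇ x then 1 else 0) + c) + inversions (y ∷ ys))
              (countLessIn≡countLess x (y ∷ ys) ys))

DifferByOne : ℕ → ℕ → Set
DifferByOne m n = m ≡ suc n ⊎ n ≡ suc m

+-differByOne : ∀ c {m n} → DifferByOne m n → DifferByOne (c + m) (c + n)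
+-differByOne zero    d              = d
+-differByOne (suc c) d with +-differByOne c d
... | inj₁ eq = inj₁ (cong suc eq)
... | inj₂ eq = inj₂ (cong suc eq)

even? : ℕ → Bool
even? k = (k % 2) ≡ᵇ 0

even?-suc : ∀ k → even? (suc k) ≡ not (even? k)
even?-suc zero          = refl
even?-suc (suc zero)    = refl
even?-suc (suc (suc k)) = even?-suc k

even?-differByOne : ∀ {m n} → DifferByOne m n → even? m ≡ not (even? n)
even?-differByOne {n = n} (inj₁ refl) = even?-suc n
even?-differByOne {m = m} (inj₂ refl) =
  trans (sym (not-involutive (even? m))) (cong not (sym (even?-suc m)))

hasParity : Bool → List ℕ → Bool
hasParity b L = if b then isEven L else not (isEven L)

hasParity-flip : ∀ b L L′ → isEven L′ ≡ not (isEven L) → T (hasParity b L) → T (hasParity (not b) L′)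
hasParity-flip true  L _ eq h = subst T (sym (trans (cong not eq) (not-involutive (isEven L)))) h
hasParity-flip false _ _ eq h = subst T (sym eq) h

-- Swapping the first two entries

swapFront : List A → List A
swapFront (x ∷ y ∷ xs) = y ∷ x ∷ xs
swapFront xs           = xs

swapFrontᵛ : Vec A n → Vec A n
swapFrontᵛ (x ∷ᵛ y ∷ᵛ xs) = y ∷ᵛ x ∷ᵛ xs
swapFrontᵛ xs             = xs

toList-swapFrontᵛ : (v : Vec A n) → toList (swapFrontᵛ v) ≡ swapFront (toList v)
toList-swapFrontᵛ []ᵛ             = refl
toList-swapFrontᵛ (x ∷ᵛ []ᵛ)      = refl
toList-swapFrontᵛ (x ∷ᵛ y ∷ᵛ xs) = refl

map-swapFront : (f : A → B) (xs : List A) → map f (swapFront xs) ≡ swapFront (map f xs)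
map-swapFront f []           = refl
map-swapFront f (x ∷ [])     = refl
map-swapFront f (x ∷ y ∷ xs) = refl

swapFront-involutive : (xs : List A) → swapFront (swapFront xs) ≡ xs
swapFront-involutive []           = refl
swapFront-involutive (x ∷ [])     = refl
swapFront-involutive (x ∷ y ∷ xs) = refl

distinct-swapFront : ∀ xs → distinct (swapFront xs) ≡ distinct xs
distinct-swapFront []           = refl
distinct-swapFront (x ∷ [])     = refl
distinct-swapFront (x ∷ y ∷ xs) rewrite ≡ᵇ-sym y x =
  ∧-interchange (not (x ≡ᵇ y)) (all (λ z → not (y ≡ᵇ z)) xs)
                (all (λ z → not (x ≡ᵇ z)) xs) (distinct xs)

⊆-swapFront : ∀ {w π : List ℕ} → w ⊆ swapFront π → w ⊆ π ⊎ swapFront w ⊆ π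
⊆-swapFront {π = []}         w⊆π                    = inj₁ w⊆π
⊆-swapFront {π = x ∷ []}     w⊆π                    = inj₁ w⊆π
⊆-swapFront {π = x ∷ y ∷ π} (refl ∷ refl ∷ w⊆π)   = inj₂ (refl ∷ refl ∷ w⊆π)
⊆-swapFront {π = x ∷ y ∷ π} (refl ∷ (x ∷ʳ w⊆π))   = inj₁ (x ∷ʳ refl ∷ w⊆π)
⊆-swapFront {π = x ∷ y ∷ π} (y ∷ʳ (refl ∷ w⊆π))   = inj₁ (refl ∷ y ∷ʳ w⊆π)
⊆-swapFront {π = x ∷ y ∷ π} (y ∷ʳ (x ∷ʳ w⊆π))     = inj₁ (x ∷ʳ y ∷ʳ w⊆π)

orderIso-swapFront-∷∷ : ∀ x y r p q t → T (not (x ≡ᵇ y)) → T (not (p ≡ᵇ q)) →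
  orderIso (y ∷ x ∷ r) (q ∷ p ∷ t) ≡ orderIso (x ∷ y ∷ r) (p ∷ q ∷ t)
orderIso-swapFront-∷∷ x y r p q t x≢y p≢q rewrite <ᵇ-flip x y x≢y | <ᵇ-flip p q p≢q
  with y <ᵇ x | q <ᵇ p
... | true  | true  = ∧-leftComm (sameHead y q r t) (sameHead x p r t) (orderIso r t)
... | true  | false = refl
... | false | true  = refl
... | false | false = ∧-leftComm (sameHead y q r t) (sameHead x p r t) (orderIso r t)

orderIso-swapFront : ∀ w s → length w ≡ length s → T (distinct w) → T (distinct s) →
  orderIso (swapFront w) (swapFront s) ≡ orderIso w s
orderIso-swapFront []           []           _  _  _  = refl
orderIso-swapFront (x ∷ [])     (p ∷ [])     _  _  _  = refl
orderIso-swapFront (x ∷ y ∷ r)  (p ∷ q ∷ t)  _  dw ds =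
  orderIso-swapFront-∷∷ x y r p q t (distinct-head x y r dw) (distinct-head p q t ds)
orderIso-swapFront []           (_ ∷ _)      ()
orderIso-swapFront (_ ∷ _)      []           ()
orderIso-swapFront (_ ∷ [])     (_ ∷ _ ∷ _)  ()
orderIso-swapFront (_ ∷ _ ∷ _)  (_ ∷ [])     ()

inversions-swapFront : ∀ x y r → T (not (x ≡ᵇ y)) →
  DifferByOne (inversions (swapFront (x ∷ y ∷ r))) (inversions (x ∷ y ∷ r))
inversions-swapFront x y r x≢y
  rewrite inversions-∷ y (x ∷ r) | inversions-∷ x (y ∷ r) | inversions-∷ x r | inversions-∷ y r
        | <ᵇ-flip x y x≢y
  with y <ᵇ x
... | true  = inj₂ (cong suc (+-leftComm (countLess x r) (countLess y r) (inversions r)))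
... | false = inj₁ (cong suc (+-leftComm (countLess y r) (countLess x r) (inversions r)))

-- Swapping the last two entries

swapLast : List A → List A
swapLast (x ∷ y ∷ [])     = y ∷ x ∷ []
swapLast (x ∷ y ∷ z ∷ xs) = x ∷ swapLast (y ∷ z ∷ xs)
swapLast xs               = xs

swapLastᵛ : Vec A n → Vec A n
swapLastᵛ (x ∷ᵛ y ∷ᵛ []ᵛ)     = y ∷ᵛ x ∷ᵛ []ᵛ
swapLastᵛ (x ∷ᵛ y ∷ᵛ z ∷ᵛ xs) = x ∷ᵛ swapLastᵛ (y ∷ᵛ z ∷ᵛ xs)
swapLastᵛ xs                  = xs

toList-swapLastᵛ : (v : Vec A n) → toList (swapLastᵛ v) ≡ swapLast (toList v)
toList-swapLastᵛ []ᵛ                  = refl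
toList-swapLastᵛ (x ∷ᵛ []ᵛ)           = refl
toList-swapLastᵛ (x ∷ᵛ y ∷ᵛ []ᵛ)      = refl
toList-swapLastᵛ (x ∷ᵛ y ∷ᵛ z ∷ᵛ xs) = cong (x ∷_) (toList-swapLastᵛ (y ∷ᵛ z ∷ᵛ xs))

map-swapLast : (f : A → B) (xs : List A) → map f (swapLast xs) ≡ swapLast (map f xs)
map-swapLast f []               = refl
map-swapLast f (x ∷ [])         = refl
map-swapLast f (x ∷ y ∷ [])     = refl
map-swapLast f (x ∷ y ∷ z ∷ xs) = cong (f x ∷_) (map-swapLast f (y ∷ z ∷ xs))

swapLast-involutive : (xs : List A) → swapLast (swapLast xs) ≡ xs
swapLast-involutive []               = refl
swapLast-involutive (x ∷ [])         = refl
swapLast-involutive (x ∷ y ∷ [])     = refl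
swapLast-involutive (x ∷ y ∷ z ∷ xs) with swapLast (y ∷ z ∷ xs) | swapLast-involutive (y ∷ z ∷ xs)
... | _ ∷ _ ∷ _ | eq = cong (x ∷_) eq

all-swapLast : ∀ (p : A → Bool) xs → all p (swapLast xs) ≡ all p xs
all-swapLast p []               = refl
all-swapLast p (x ∷ [])         = refl
all-swapLast p (x ∷ y ∷ [])     = ∧-leftComm (p y) (p x) true
all-swapLast p (x ∷ y ∷ z ∷ xs) = cong (p x ∧_) (all-swapLast p (y ∷ z ∷ xs))

distinct-swapLast : ∀ xs → distinct (swapLast xs) ≡ distinct xs
distinct-swapLast []               = refl
distinct-swapLast (x ∷ [])         = refl
distinct-swapLast (x ∷ y ∷ [])     = distinct-swapFront (x ∷ y ∷ [])
distinct-swapLast (x ∷ y ∷ z ∷ xs) =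
  cong₂ _∧_ (all-swapLast (λ u → not (x ≡ᵇ u)) (y ∷ z ∷ xs)) (distinct-swapLast (y ∷ z ∷ xs))

∷-⊆-swapLast : ∀ x w {π : List ℕ} → swapLast w ⊆ π → x ∷ w ⊆ x ∷ π ⊎ swapLast (x ∷ w) ⊆ x ∷ π
∷-⊆-swapLast x []          w⊆π = inj₁ (refl ∷ w⊆π)
∷-⊆-swapLast x (_ ∷ [])    w⊆π = inj₁ (refl ∷ w⊆π)
∷-⊆-swapLast x (_ ∷ _ ∷ _) w⊆π = inj₂ (refl ∷ w⊆π)

⊆-swapLast : ∀ {w π : List ℕ} → w ⊆ swapLast π → w ⊆ π ⊎ swapLast w ⊆ π
⊆-swapLast {π = []}             w⊆π                  = inj₁ w⊆π
⊆-swapLast {π = x ∷ []}         w⊆π                  = inj₁ w⊆π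
⊆-swapLast {π = x ∷ y ∷ []}     (refl ∷ refl ∷ [])   = inj₂ (refl ∷ refl ∷ [])
⊆-swapLast {π = x ∷ y ∷ []}     (refl ∷ (x ∷ʳ []))   = inj₁ (x ∷ʳ refl ∷ [])
⊆-swapLast {π = x ∷ y ∷ []}     (y ∷ʳ (refl ∷ []))   = inj₁ (refl ∷ y ∷ʳ [])
⊆-swapLast {π = x ∷ y ∷ []}     (y ∷ʳ (x ∷ʳ []))     = inj₁ (x ∷ʳ y ∷ʳ [])
⊆-swapLast {π = x ∷ y ∷ z ∷ π} (x ∷ʳ w⊆π) with ⊆-swapLast {π = y ∷ z ∷ π} w⊆π
... | inj₁ w⊆π′ = inj₁ (x ∷ʳ w⊆π′)
... | inj₂ w⊆π′ = inj₂ (x ∷ʳ w⊆π′)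
⊆-swapLast {π = x ∷ y ∷ z ∷ π} (_∷_ {xs = w} refl w⊆π) with ⊆-swapLast {π = y ∷ z ∷ π} w⊆π
... | inj₁ w⊆π′ = inj₁ (refl ∷ w⊆π′)
... | inj₂ w⊆π′ = ∷-⊆-swapLast x w w⊆π′

sameHead-∷ : ∀ a b x p w s → sameHead a b (x ∷ w) (p ∷ s) ≡ sameHead a b [ x ] [ p ] ∧ sameHead a b w s
sameHead-∷ a b x p w s with x <ᵇ a | p <ᵇ b
... | true  | true  = refl
... | true  | false = refl
... | false | true  = refl
... | false | false = refl

sameHead-swapLast : ∀ a b w s → length w ≡ length s →
  sameHead a b (swapLast w) (swapLast s) ≡ sameHead a b w s
sameHead-swapLast a b []              []              _  = refl
sameHead-swapLast a b (x ∷ [])        (p ∷ [])        _  = refl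
sameHead-swapLast a b (x ∷ y ∷ [])    (p ∷ q ∷ [])    _  = begin
  sameHead a b (y ∷ x ∷ []) (q ∷ p ∷ [])              ≡⟨ sameHead-∷ a b y q [ x ] [ p ] ⟩
  sameHead a b [ y ] [ q ] ∧ sameHead a b [ x ] [ p ] ≡⟨ ∧-comm (sameHead a b [ y ] [ q ]) _ ⟩
  sameHead a b [ x ] [ p ] ∧ sameHead a b [ y ] [ q ] ≡⟨ sym (sameHead-∷ a b x p [ y ] [ q ]) ⟩
  sameHead a b (x ∷ y ∷ []) (p ∷ q ∷ [])              ∎
sameHead-swapLast a b (x ∷ w@(_ ∷ _ ∷ _)) (p ∷ s@(_ ∷ _ ∷ _)) eq = begin
  sameHead a b (x ∷ swapLast w) (p ∷ swapLast s)           ≡⟨ sameHead-∷ a b x p (swapLast w) (swapLast s) ⟩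
  sameHead a b [ x ] [ p ] ∧ sameHead a b (swapLast w) (swapLast s)
    ≡⟨ cong (sameHead a b [ x ] [ p ] ∧_) (sameHead-swapLast a b w s (cong pred eq)) ⟩
  sameHead a b [ x ] [ p ] ∧ sameHead a b w s              ≡⟨ sym (sameHead-∷ a b x p w s) ⟩
  sameHead a b (x ∷ w) (p ∷ s)                             ∎
sameHead-swapLast a b []              (_ ∷ _)         ()
sameHead-swapLast a b (_ ∷ _)         []              ()
sameHead-swapLast a b (_ ∷ [])        (_ ∷ _ ∷ _)     ()
sameHead-swapLast a b (_ ∷ _ ∷ _)     (_ ∷ [])        ()
sameHead-swapLast a b (_ ∷ _ ∷ [])    (_ ∷ _ ∷ _ ∷ _) ()
sameHead-swapLast a b (_ ∷ _ ∷ _ ∷ _) (_ ∷ _ ∷ [])    ()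

orderIso-swapLast : ∀ w s → length w ≡ length s → T (distinct w) → T (distinct s) →
  orderIso (swapLast w) (swapLast s) ≡ orderIso w s
orderIso-swapLast []              []              _  _  _  = refl
orderIso-swapLast (x ∷ [])        (p ∷ [])        _  _  _  = refl
orderIso-swapLast (x ∷ y ∷ [])    (p ∷ q ∷ [])    _  dw ds =
  orderIso-swapFront-∷∷ x y [] p q [] (distinct-head x y [] dw) (distinct-head p q [] ds)
orderIso-swapLast (x ∷ w@(_ ∷ _ ∷ _)) (p ∷ s@(_ ∷ _ ∷ _)) eq dw ds =
  cong₂ _∧_ (sameHead-swapLast x p w s (cong pred eq))
            (orderIso-swapLast w s (cong pred eq) (distinct-tail x w dw) (distinct-tail p s ds))
orderIso-swapLast []              (_ ∷ _)         ()
orderIso-swapLast (_ ∷ _)         []              ()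
orderIso-swapLast (_ ∷ [])        (_ ∷ _ ∷ _)     ()
orderIso-swapLast (_ ∷ _ ∷ _)     (_ ∷ [])        ()
orderIso-swapLast (_ ∷ _ ∷ [])    (_ ∷ _ ∷ _ ∷ _) ()
orderIso-swapLast (_ ∷ _ ∷ _ ∷ _) (_ ∷ _ ∷ [])    ()

countLess-swapLast : ∀ x ys → countLess x (swapLast ys) ≡ countLess x ys
countLess-swapLast x []               = refl
countLess-swapLast x (y ∷ [])         = refl
countLess-swapLast x (y ∷ z ∷ [])     = +-leftComm (if z <ᵇ x then 1 else 0) (if y <ᵇ x then 1 else 0) 0
countLess-swapLast x (y ∷ z ∷ u ∷ ys) =
  cong ((if y <ᵇ x then 1 else 0) +_) (countLess-swapLast x (z ∷ u ∷ ys))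

inversions-swapLast : ∀ x y r → T (distinct (x ∷ y ∷ r)) →
  DifferByOne (inversions (swapLast (x ∷ y ∷ r))) (inversions (x ∷ y ∷ r))
inversions-swapLast x y []      d = inversions-swapFront x y [] (distinct-head x y [] d)
inversions-swapLast x y (z ∷ r) d
  rewrite inversions-∷ x (swapLast (y ∷ z ∷ r)) | inversions-∷ x (y ∷ z ∷ r)
        | countLess-swapLast x (y ∷ z ∷ r)
  = +-differByOne (countLess x (y ∷ z ∷ r)) (inversions-swapLast y z r (distinct-tail x (y ∷ z ∷ r) d))

-- A sign-reversing involution

record AdjacentTransposition : Set₁ where
  field
    swap            : List A → List A
    swapᵛ           : Vec A n → Vec A n
    toList-swapᵛ    : (v : Vec A n) → toList (swapᵛ v) ≡ swap (toList v)
    map-swap        : (f : A → B) (xs : List A) → map f (swap xs) ≡ swap (map f xs)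
    swap-involutive : (xs : List A) → swap (swap xs) ≡ xs
    distinct-swap   : ∀ xs → distinct (swap xs) ≡ distinct xs
    ⊆-swap          : ∀ {w π : List ℕ} → w ⊆ swap π → w ⊆ π ⊎ swap w ⊆ π
    orderIso-swap   : ∀ w s → length w ≡ length s → T (distinct w) → T (distinct s) →
                      orderIso (swap w) (swap s) ≡ orderIso w s
    inversions-swap : ∀ x y xs → T (distinct (x ∷ y ∷ xs)) →
                      DifferByOne (inversions (swap (x ∷ y ∷ xs))) (inversions (x ∷ y ∷ xs))

transposeFront : AdjacentTransposition
transposeFront = record
  { swap            = swapFront
  ; swapᵛ           = swapFrontᵛ
  ; toList-swapᵛ    = toList-swapFrontᵛ
  ; map-swap        = map-swapFront
  ; swap-involutive = swapFront-involutive
  ; distinct-swap   = distinct-swapFront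
  ; ⊆-swap          = ⊆-swapFront
  ; orderIso-swap   = orderIso-swapFront
  ; inversions-swap = λ x y xs → inversions-swapFront x y xs ∘ distinct-head x y xs
  }

transposeLast : AdjacentTransposition
transposeLast = record
  { swap            = swapLast
  ; swapᵛ           = swapLastᵛ
  ; toList-swapᵛ    = toList-swapLastᵛ
  ; map-swap        = map-swapLast
  ; swap-involutive = swapLast-involutive
  ; distinct-swap   = distinct-swapLast
  ; ⊆-swap          = ⊆-swapLast
  ; orderIso-swap   = orderIso-swapLast
  ; inversions-swap = inversions-swapLast
  }

module SignReversal (τ : AdjacentTransposition) where
  open AdjacentTransposition τ

  swapᵛ-involutive : (v : Vec A n) → swapᵛ (swapᵛ v) ≡ v
  swapᵛ-involutive v = toList-injective-≡ _ v (begin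
    toList (swapᵛ (swapᵛ v)) ≡⟨ toList-swapᵛ (swapᵛ v) ⟩
    swap (toList (swapᵛ v))  ≡⟨ cong swap (toList-swapᵛ v) ⟩
    swap (swap (toList v))   ≡⟨ swap-involutive (toList v) ⟩
    toList v                 ∎)

  oneLine-swapᵛ : (v : Vec (Fin n) n) → oneLine (swapᵛ v) ≡ swap (oneLine v)
  oneLine-swapᵛ v = trans (cong (map toℕ) (toList-swapᵛ v)) (map-swap toℕ (toList v))

  contains-swap : ∀ {π σ} → T (distinct π) → T (distinct σ) →
    T (contains (swap π) σ) → T (contains π σ) ⊎ T (contains π (swap σ))
  contains-swap {π} {σ} dπ dσ c with contains⁻ (swap π) σ c
  ... | w , w⊆swapπ , o with ⊆-swap w⊆swapπ
  ...   | inj₁ w⊆π = inj₁ (contains⁺ σ w⊆π o)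
  ...   | inj₂ swapw⊆π = inj₂ (contains⁺ (swap σ) swapw⊆π
          (subst T (sym (orderIso-swap w σ (orderIso-length w σ o)
                          (subst T (distinct-swap w) (distinct-⊆ swapw⊆π dπ)) dσ)) o))

  avoids-swap : ∀ {π σ} → T (distinct π) → T (distinct σ) →
    T (avoids π σ) → T (avoids π (swap σ)) → T (avoids (swap π) σ)
  avoids-swap dπ dσ a a′ = T-not⁺ λ c → [ T-not⁻ a , T-not⁻ a′ ]′ (contains-swap dπ dσ c)

  avoiderOfParity : List ℕ → Bool → List ℕ → Bool
  avoiderOfParity σ b L = distinct L ∧ avoids L σ ∧ avoids L (swap σ) ∧ hasParity b L

  avoiderOfParity-swap : ∀ σ → T (distinct σ) → ∀ b L →
    (T (distinct L) → DifferByOne (inversions (swap L)) (inversions L)) →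
    T (avoiderOfParity σ b L) → T (avoiderOfParity σ (not b) (swap L))
  avoiderOfParity-swap σ dσ b L flips h =
    let dL , h₁ = T-∧⁻ h ; a , h₂ = T-∧⁻ h₁ ; a′ , p = T-∧⁻ h₂
        a″ = subst (T ∘ avoids L) (sym (swap-involutive σ)) a
        dswapσ = subst T (sym (distinct-swap σ)) dσ
    in T-∧⁺ (subst T (sym (distinct-swap L)) dL)
         (T-∧⁺ (avoids-swap dL dσ a a′)
           (T-∧⁺ (avoids-swap dL dswapσ a′ a″)
             (hasParity-flip b L (swap L) (even?-differByOne (flips dL)) p)))

  module _ (σ : List ℕ) (dσ : T (distinct σ)) (m : ℕ) where
    N : ℕ
    N = suc (suc m)

    inS-swapᵛ : ∀ b (v : Vec (Fin N) N) →
      T (inS N σ (swap σ) b v) → T (inS N σ (swap σ) (not b) (swapᵛ v))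
    inS-swapᵛ b v@(x ∷ᵛ y ∷ᵛ vs) h =
      subst (T ∘ avoiderOfParity σ (not b)) (sym (oneLine-swapᵛ v))
            (avoiderOfParity-swap σ dσ b _ (inversions-swap (toℕ x) (toℕ y) (map toℕ (toList vs))) h)

    swapAvoider : ∀ b → AvoidersOfParity N σ (swap σ) b → AvoidersOfParity N σ (swap σ) (not b)
    swapAvoider b (v , h) = swapᵛ v , inS-swapᵛ b v h

    signBalanced : SignBalanced N σ (swap σ)
    signBalanced = mk↔ₛ′ (swapAvoider true) (swapAvoider false)
      (λ (v , _) → Σ-T-≡ (swapᵛ-involutive v)) (λ (v , _) → Σ-T-≡ (swapᵛ-involutive v))

open SignReversal using (signBalanced)

proposition3p7 : ∀ (σ₁ σ₂ : List ℕ) → (σ₁ , σ₂) ∈ pairs →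
                   ∀ (n : ℕ) → 1 < n → SignBalanced n σ₁ σ₂
proposition3p7 _ _ (here refl)                         (suc (suc m)) (s≤s (s≤s z≤n)) =
  signBalanced transposeLast (1 ∷ 4 ∷ 2 ∷ 3 ∷ []) tt m
proposition3p7 _ _ (there (here refl))                 (suc (suc m)) (s≤s (s≤s z≤n)) =
  signBalanced transposeFront (3 ∷ 2 ∷ 4 ∷ 1 ∷ []) tt m
proposition3p7 _ _ (there (there (here refl)))         (suc (suc m)) (s≤s (s≤s z≤n)) =
  signBalanced transposeLast (4 ∷ 1 ∷ 3 ∷ 2 ∷ []) tt m
proposition3p7 _ _ (there (there (there (here refl)))) (suc (suc m)) (s≤s (s≤s z≤n)) =
  signBalanced transposeFront (2 ∷ 3 ∷ 1 ∷ 4 ∷ []) tt m
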